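{- Let $n$ be a positive integer, let $2\le k\le 2n-2$, let $y_1<y_2<\cdots<y_k$ be the $k$ consecutive integers $2n-k-1,2n-k,\ldots,2n-2$, and let $p$ be an integer. Then there is a set of $k$ integers, not containing $p$, contained in $S_{2n+1}(2n+1)$, whose elements sum to $y_1+\cdots+y_k$.
   Context: For an integer $m\ge3$, $S_m$ is the sequence defined greedily by $a_0=0$ and, having chosen $a_0,\ldots,a_k$, $a_{k+1}$ is the least integer greater than $a_k$ such that there are no distinct $x_1,\ldots,x_m\in\{a_0,\ldots,a_{k+1}\}$ with $x_1+\cdots+x_{m-1}=(m-1)x_m$. $S_m(k)$ denotes the set of terms of $S_m$ that are at most $k$. -}

module Defs where

open import Data.Nat using (ℕ; zero; suc; _+_; _*_; _∸_; _≤_; _<_)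
open import Data.Fin using (Fin; inject₁; fromℕ)
open import Data.List using (List; map; allFin)
open import Data.Nat.ListAction using (sum)
open import Data.Product using (Σ; _×_)
open import Data.Sum using (_⊎_)
open import Relation.Nullary using (¬_)
open import Relation.Binary.PropositionalEquality using (_≡_)
open import Function using (_∘_)
open import Function.Definitions using (Injective)

-- HasSolution m A : there are distinct x₁,…,x_m ∈ A with
--   x₁ + ⋯ + x_{m-1} = (m-1) x_m.
-- The m elements are given as an injective map x : Fin m → ℕ; index
-- fromℕ (m-1) is x_m, the indices inject₁ t (t : Fin (m-1)) are x₁…x_{m-1}.
HasSolution′ : (r : ℕ) → (ℕ → Set) → Set
HasSolution′ r A =
  Σ (Fin (suc r) → ℕ) λ x →
    Injective _≡_ _≡_ x
    × (∀ t → A (x t))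
    × sum (map (x ∘ inject₁) (allFin r)) ≡ r * x (fromℕ r)

HasSolution : ℕ → (ℕ → Set) → Set
HasSolution m A = HasSolution′ (m ∸ 1) A

InPrefix : (ℕ → ℕ) → ℕ → ℕ → Set
InPrefix a j y = Σ ℕ λ i → i ≤ j × a i ≡ y

IsGreedy : ℕ → (ℕ → ℕ) → Set
IsGreedy m a =
  a 0 ≡ 0
  × (∀ j → a j < a (suc j)
         × ¬ HasSolution m (InPrefix a (suc j))
         × (∀ c → a j < c → c < a (suc j) →
              HasSolution m (λ y → InPrefix a j y ⊎ y ≡ c)))

InS : (ℕ → ℕ) → ℕ → ℕ → Set
InS a K x = Σ ℕ λ i → a i ≡ x × x ≤ K

module Submission where

-- Idea of the proof.  Let c = 2n-k-1, so that the target sum is that of the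
-- interval [c, c+k) and c+k = 2n-1; the hypotheses give c ≥ 1, and c ≥ 2
-- when k is odd (c+k+1 = 2n is even).
--
-- (1) Greedy prefix: a solution of x₁+⋯+x_{m-1} = (m-1)x_m needs m distinct
--     elements, so the greedy sequence S_m begins 0, 1, …, m-2.  For m = 2n+1
--     every x < 2n lies in S_{2n+1}(2n+1).
-- (2) Exchange: in a duplicate-free list, replacing two members p ≠ y by two
--     new values u ≠ v with u + v = p + y keeps length, sum and distinctness,
--     and the result omits p.
-- (3) Intervals: if p ∉ [c, c+k) the interval itself works.  Otherwise p = c+i
--     and we exchange p and its mirror c+(k-1-i) for c-1 and c+k; if p is the
--     centre (k = 2i+1) we exchange p and p-1 for c-2 and c+k instead.
--     All values used lie in [0, c+k] = [0, 2n-1], hence in S_{2n+1}(2n+1).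

open import Defs
open import Data.Nat using (ℕ; zero; suc; _+_; _*_; _∸_; _≤_; _<_; z≤n; s≤s; _≟_)
open import Data.Nat.Properties
open import Data.Nat.Solver using (module +-*-Solver)
open import Data.Nat.ListAction using (sum)
open import Data.Nat.ListAction.Properties using (sum-↭)
open import Data.Integer using (ℤ; +_; -[1+_])
import Data.Integer.Properties as ℤ
open import Data.List using (List; _∷_; _++_; length; map; upTo)
open import Data.List.Properties using (length-map; length-upTo)
open import Data.List.Relation.Unary.All using (All; _∷_)
import Data.List.Relation.Unary.All as All
open import Data.List.Relation.Unary.Any using (here; there)
open import Data.List.Relation.Unary.AllPairs using (_∷_)
open import Data.List.Relation.Unary.Unique.Propositional using (Unique)
import Data.List.Relation.Unary.Unique.Propositional.Properties as Unique
open import Data.List.Membership.Propositional using (_∈_; _∉_)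
open import Data.List.Membership.Propositional.Properties
  using (∈-∃++; ∈-map⁺; ∈-map⁻; ∈-upTo⁺; ∈-upTo⁻)
open import Data.List.Membership.DecPropositional _≟_ using (_∈?_)
open import Data.List.Relation.Binary.Permutation.Propositional
  using (_↭_; prep; ↭-sym; ↭-trans; ↭⇒↭ₛ)
open import Data.List.Relation.Binary.Permutation.Propositional.Properties
  using (shift; ∈-resp-↭; All-resp-↭; ↭-length)
open import Relation.Binary.PropositionalEquality
  using (_≡_; _≢_; refl; sym; trans; cong; subst; setoid; module ≡-Reasoning)
open import Data.List.Relation.Binary.Permutation.Setoid.Properties (setoid ℕ)
  using (Unique-resp-↭)
open import Data.Product using (Σ; ∃; _×_; _,_; proj₁; proj₂)
open import Data.Sum using (_⊎_; inj₁; inj₂)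
open import Data.Fin using (Fin; fromℕ<; toℕ)
open import Data.Fin.Properties using (injective⇒≤; toℕ-fromℕ<)
open import Function using (_∘_)
open import Relation.Nullary using (¬_; yes; no; contradiction)

-- Pigeonhole: a solution uses r+1 distinct elements, so it cannot live
-- inside a set whose elements are all below B unless r+1 ≤ B.
solution-size : ∀ r (A : ℕ → Set) B → HasSolution′ r A → (∀ y → A y → y < B) → suc r ≤ B
solution-size r A B (x , x-injective , x∈A , _) bounded = injective⇒≤ {f = index} index-injective
  where
  index : Fin (suc r) → Fin B
  index t = fromℕ< (bounded (x t) (x∈A t))
  index-injective : ∀ {t u} → index t ≡ index u → t ≡ u
  index-injective {t} {u} e = x-injective (begin
    x t               ≡⟨ toℕ-fromℕ< (bounded (x t) (x∈A t)) ⟨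
    toℕ (index t)     ≡⟨ cong toℕ e ⟩
    toℕ (index u)     ≡⟨ toℕ-fromℕ< (bounded (x u) (x∈A u)) ⟩
    x u               ∎)
    where open ≡-Reasoning

-- The greedy sequence S_{r+1} starts 0, 1, …, r-1: as long as the prefix has
-- at most r elements, no solution (which needs r+1 elements) can arise, so
-- the greedy choice is always the next integer.
module GreedyPrefix (r : ℕ) (a : ℕ → ℕ) (greedy : IsGreedy (suc r) a) where

  IdentityUpTo : ℕ → Set
  IdentityUpTo j = ∀ i → i ≤ j → a i ≡ i

  identity-up-to : ∀ j → j < r → IdentityUpTo j
  identity-up-to zero _ .zero z≤n = proj₁ greedy
  identity-up-to (suc j) j+1<r = extend (identity-up-to j (<-trans (n<1+n j) j+1<r))
    where
    increasing : a j < a (suc j)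
    increasing = proj₁ (proj₂ greedy j)

    -- If a (j+1) ≠ j+1, the smaller candidate j+1 was rejected, which needs
    -- a solution among j+2 numbers; impossible since j+2 ≤ r.
    next : IdentityUpTo j → a (suc j) ≡ suc j
    next prefix with suc j ≟ a (suc j)
    ... | yes e = sym e
    ... | no j+1≢a = contradiction (≤-pred r+1≤j+2) (<⇒≱ j+1<r)
      where
      aj≡j : a j ≡ j
      aj≡j = prefix j ≤-refl
      skipped : suc j < a (suc j)
      skipped = ≤∧≢⇒< (subst (λ z → suc z ≤ a (suc j)) aj≡j increasing) j+1≢a
      rejected : HasSolution (suc r) (λ y → InPrefix a j y ⊎ y ≡ suc j)
      rejected = proj₂ (proj₂ (proj₂ greedy j)) (suc j) (subst (_< suc j) (sym aj≡j) ≤-refl) skipped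
      small : ∀ y → (InPrefix a j y ⊎ y ≡ suc j) → y < suc (suc j)
      small y (inj₁ (i , i≤j , ai≡y)) = s≤s (≤-trans (≤-reflexive (trans (sym ai≡y) (prefix i i≤j))) (m≤n⇒m≤1+n i≤j))
      small y (inj₂ refl) = ≤-refl
      r+1≤j+2 : suc r ≤ suc (suc j)
      r+1≤j+2 = solution-size r _ (suc (suc j)) rejected small

    extend : IdentityUpTo j → IdentityUpTo (suc j)
    extend prefix i i≤j+1 with m≤n⇒m<n∨m≡n i≤j+1
    ... | inj₁ i<j+1 = prefix i (≤-pred i<j+1)
    ... | inj₂ refl = next prefix

  identity : ∀ i → i < r → a i ≡ i
  identity i i<r = identity-up-to i i<r i ≤-refl

small-in-S : ∀ n a → IsGreedy (2 * n + 1) a → ∀ x → x < 2 * n → InS a (2 * n + 1) x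
small-in-S n a greedy x x<2n =
  x , GreedyPrefix.identity (2 * n) a greedy′ x x<2n , ≤-trans (<⇒≤ x<2n) (m≤m+n (2 * n) 1)
  where
  greedy′ : IsGreedy (suc (2 * n)) a
  greedy′ = subst (λ m → IsGreedy m a) (+-comm (2 * n) 1) greedy

Avoiding : (ℕ → Set) → ℕ → ℕ → ℕ → Set
Avoiding P k s q = Σ (List ℕ) λ xs →
  length xs ≡ k × Unique xs × All P xs × q ∉ xs × sum xs ≡ s

extract : ∀ {x : ℕ} {xs} → x ∈ xs → Σ (List ℕ) λ rest → xs ↭ x ∷ rest
extract x∈xs with ys , zs , refl ← ∈-∃++ x∈xs = ys ++ zs , shift _ ys zs

extract-two : ∀ {p y : ℕ} {xs} → p ∈ xs → y ∈ xs → y ≢ p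
  → Σ (List ℕ) λ rest → xs ↭ p ∷ y ∷ rest
extract-two p∈xs y∈xs y≢p with extract p∈xs
... | rest₁ , σ₁ with ∈-resp-↭ σ₁ y∈xs
...   | here y≡p = contradiction y≡p y≢p
...   | there y∈rest₁ with rest₂ , σ₂ ← extract y∈rest₁ = rest₂ , ↭-trans σ₁ (prep _ σ₂)

exchange : ∀ {P : ℕ → Set} {xs p y u v} → Unique xs → p ∈ xs → y ∈ xs → y ≢ p
  → u ∉ xs → v ∉ xs → u ≢ v → u + v ≡ p + y → All P xs → P u → P v
  → Avoiding P (length xs) (sum xs) p
exchange {P} {xs} {p} {y} {u} {v} unique p∈xs y∈xs y≢p u∉xs v∉xs u≢v balance Pxs Pu Pv
  with rest , σ ← extract-two p∈xs y∈xs y≢p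
  with p∉rest′ ∷ _ ∷ unique-rest ← Unique-resp-↭ (↭⇒↭ₛ σ) unique
  with _ ∷ _ ∷ Prest ← All-resp-↭ σ Pxs =
  u ∷ v ∷ rest , length-eq , unique-new , Pu ∷ Pv ∷ Prest , p∉new , sum-eq
  where
  rest⊆xs : ∀ {z} → z ∈ rest → z ∈ xs
  rest⊆xs z∈rest = ∈-resp-↭ (↭-sym σ) (there (there z∈rest))
  fresh : ∀ {w} → w ∉ xs → All (w ≢_) rest
  fresh w∉xs = All.tabulate λ z∈rest w≡z → w∉xs (subst (_∈ xs) (sym w≡z) (rest⊆xs z∈rest))
  unique-new : Unique (u ∷ v ∷ rest)
  unique-new = (u≢v ∷ fresh u∉xs) ∷ fresh v∉xs ∷ unique-rest
  p∉new : p ∉ u ∷ v ∷ rest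
  p∉new (here p≡u) = u∉xs (subst (_∈ xs) p≡u p∈xs)
  p∉new (there (here p≡v)) = v∉xs (subst (_∈ xs) p≡v p∈xs)
  p∉new (there (there p∈rest)) = All.lookup p∉rest′ (there p∈rest) refl
  length-eq : length (u ∷ v ∷ rest) ≡ length xs
  length-eq = ↭-length (↭-sym σ)
  sum-eq : sum (u ∷ v ∷ rest) ≡ sum xs
  sum-eq = begin
    u + (v + sum rest)  ≡⟨ +-assoc u v _ ⟨
    u + v + sum rest    ≡⟨ cong (_+ sum rest) balance ⟩
    p + y + sum rest    ≡⟨ +-assoc p y _ ⟩
    sum (p ∷ y ∷ rest)  ≡⟨ sum-↭ (↭-sym σ) ⟩
    sum xs              ∎
    where open ≡-Reasoning

-- The interval [c, c+k), written exactly as in the statement of lemma8.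
interval : ℕ → ℕ → List ℕ
interval c k = map (λ i → c + i) (upTo k)

interval-length : ∀ c k → length (interval c k) ≡ k
interval-length c k = trans (length-map _ (upTo k)) (length-upTo k)

interval-unique : ∀ c k → Unique (interval c k)
interval-unique c k = Unique.map⁺ (+-cancelˡ-≡ c _ _) (Unique.upTo⁺ k)

interval-∈ : ∀ {c k i} → i < k → c + i ∈ interval c k
interval-∈ i<k = ∈-map⁺ _ (∈-upTo⁺ i<k)

interval-∈⁻ : ∀ {c k x} → x ∈ interval c k → ∃ λ i → i < k × x ≡ c + i
interval-∈⁻ x∈ with i , i∈ , x≡c+i ← ∈-map⁻ _ x∈ = i , ∈-upTo⁻ i∈ , x≡c+i

interval-bounds : ∀ {c k x} → x ∈ interval c k → c ≤ x × x < c + k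
interval-bounds {c} x∈ with i , i<k , refl ← interval-∈⁻ x∈ = m≤m+n c i , +-monoʳ-< c i<k

interval-exchange : ∀ {c k i j u} → i < k → j < k → j ≢ i → u < c
  → u + (c + k) ≡ (c + i) + (c + j)
  → Avoiding (_≤ c + k) k (sum (interval c k)) (c + i)
interval-exchange {c} {k} {i} {j} {u} i<k j<k j≢i u<c balance =
  subst (λ l → Avoiding (_≤ c + k) l (sum (interval c k)) (c + i)) (interval-length c k)
    (exchange (interval-unique c k) (interval-∈ i<k) (interval-∈ j<k) (j≢i ∘ +-cancelˡ-≡ c j i)
      u∉ v∉ (<⇒≢ u<c+k) balance
      (All.tabulate (<⇒≤ ∘ proj₂ ∘ interval-bounds)) (<⇒≤ u<c+k) ≤-refl)
  where
  u<c+k : u < c + k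
  u<c+k = ≤-trans u<c (m≤m+n c k)
  u∉ : u ∉ interval c k
  u∉ u∈ = <⇒≱ u<c (proj₁ (interval-bounds u∈))
  v∉ : c + k ∉ interval c k
  v∉ v∈ = <-irrefl refl (proj₂ (interval-bounds v∈))

open +-*-Solver using (solve; _:+_; _:*_; _:=_; con)

-- Avoiding c+i, a point of the interval [c, c+suc (i+j)).  Off-centre we trade
-- c+i and its mirror c+j for c-1 and the right end; at the centre (i = j) we
-- trade c+i and c+i-1 for c-2 and the right end, which needs c ≥ 2 and i ≥ 1.
avoid-inside : ∀ c i j → 1 ≤ c → 2 ≤ suc (i + j) → (∀ m → suc (i + j) ≡ suc (2 * m) → 2 ≤ c)
  → Avoiding (_≤ c + suc (i + j)) (suc (i + j)) (sum (interval c (suc (i + j)))) (c + i)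
avoid-inside (suc c′) i j _ _ _ with j ≟ i
... | no j≢i = interval-exchange (s≤s (m≤m+n i j)) (s≤s (m≤n+m j i)) j≢i ≤-refl
  (solve 3 (λ c i j → c :+ ((con 1 :+ c) :+ (con 1 :+ (i :+ j)))
                    := ((con 1 :+ c) :+ i) :+ ((con 1 :+ c) :+ j)) refl c′ i j)
avoid-inside (suc c′) zero .zero _ (s≤s ()) _ | yes refl
avoid-inside (suc zero) (suc i′) .(suc i′) _ _ odd⇒2≤c | yes refl =
  contradiction (odd⇒2≤c (suc i′) (cong (λ t → suc (suc i′ + t)) (sym (+-identityʳ (suc i′))))) λ { (s≤s ()) }
avoid-inside (suc (suc c″)) (suc i′) .(suc i′) _ _ _ | yes refl =
  interval-exchange (s≤s (m≤m+n (suc i′) (suc i′))) (s≤s (≤-trans (n≤1+n i′) (m≤m+n (suc i′) (suc i′))))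
    (1+n≢n ∘ sym) (n≤1+n (suc c″))
    (solve 2 (λ c i → c :+ ((con 2 :+ c) :+ (con 1 :+ ((con 1 :+ i) :+ (con 1 :+ i))))
                   := ((con 2 :+ c) :+ (con 1 :+ i)) :+ ((con 2 :+ c) :+ i)) refl c″ i′)

interval-avoiding : ∀ c k q → 1 ≤ c → 2 ≤ k → (∀ m → k ≡ suc (2 * m) → 2 ≤ c)
  → Avoiding (_≤ c + k) k (sum (interval c k)) q
interval-avoiding c k q 1≤c 2≤k odd⇒2≤c with q ∈? interval c k
... | no q∉ = interval c k , interval-length c k , interval-unique c k
  , All.tabulate (<⇒≤ ∘ proj₂ ∘ interval-bounds) , q∉ , refl
... | yes q∈ with i , i<k , refl ← interval-∈⁻ q∈ with j , refl ← m≤n⇒∃[o]m+o≡n i<k =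
  avoid-inside c i j 1≤c 2≤k odd⇒2≤c

natural-target : (p : ℤ) → Σ ℕ λ q → ∀ x → x ≢ q → ¬ (+ x ≡ p)
natural-target (+ q) = q , λ x x≢q e → x≢q (ℤ.+-injective e)
natural-target -[1+ m ] = 0 , λ x _ ()

interval-start : ∀ n k → 1 ≤ n → k ≤ 2 * n ∸ 2
  → Σ ℕ λ e → 2 * n ∸ k ∸ 1 ≡ suc e × 2 * n ≡ k + (2 + e)
interval-start n k 1≤n k≤ with e , k+e≡ ← m≤n⇒∃[o]m+o≡n k≤ = e , start , total
  where
  total : 2 * n ≡ k + (2 + e)
  total = begin
    2 * n            ≡⟨ m∸n+n≡m (*-monoʳ-≤ 2 1≤n) ⟨
    2 * n ∸ 2 + 2    ≡⟨ cong (_+ 2) k+e≡ ⟨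
    k + e + 2        ≡⟨ +-assoc k e 2 ⟩
    k + (e + 2)      ≡⟨ cong (λ t → k + t) (+-comm e 2) ⟩
    k + (2 + e)      ∎
    where open ≡-Reasoning
  start : 2 * n ∸ k ∸ 1 ≡ suc e
  start = cong (_∸ 1) (trans (cong (_∸ k) total) (m+n∸m≡n k (2 + e)))

below-2n : ∀ n k e → 2 * n ≡ k + (2 + e) → ∀ {x} → x ≤ suc e + k → x < 2 * n
below-2n n k e total {x} x≤ = subst (x <_) (sym total) (≤-trans (s≤s x≤) (≤-reflexive
  (solve 2 (λ k e → con 1 :+ ((con 1 :+ e) :+ k) := k :+ (con 2 :+ e)) refl k e)))

odd⇒start≥2 : ∀ n k e → 2 * n ≡ k + (2 + e) → ∀ m → k ≡ suc (2 * m) → 2 ≤ suc e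
odd⇒start≥2 n k (suc _) _ _ _ = s≤s (s≤s z≤n)
odd⇒start≥2 n k zero total m refl = contradiction (trans total (solve 1
  (λ m → (con 1 :+ con 2 :* m) :+ con 2 := con 1 :+ con 2 :* (con 1 :+ m)) refl m))
  (even≢odd n (suc m))

lemma8 : (n k : ℕ) → 1 ≤ n → 2 ≤ k → k ≤ 2 * n ∸ 2 → (p : ℤ)
    → (a : ℕ → ℕ) → IsGreedy (2 * n + 1) a
    → Σ (List ℕ) λ xs →
        length xs ≡ k
        × Unique xs
        × All (InS a (2 * n + 1)) xs
        × All (λ x → ¬ (+ x ≡ p)) xs
        × sum xs ≡ sum (map (λ i → (2 * n ∸ k ∸ 1) + i) (upTo k))
lemma8 n k 1≤n 2≤k k≤ p a greedy
  with e , c≡ , total ← interval-start n k 1≤n k≤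
  with q , avoids-p ← natural-target p
  with xs , length-xs , unique , bounded , q∉xs , sum-xs
         ← interval-avoiding (suc e) k q (s≤s z≤n) 2≤k (odd⇒start≥2 n k e total) =
  xs , length-xs , unique
  , All.map (small-in-S n a greedy _ ∘ below-2n n k e total) bounded
  , All.tabulate (λ {x} x∈ → avoids-p x λ x≡q → q∉xs (subst (_∈ xs) x≡q x∈))
  , trans sum-xs (cong (λ c → sum (interval c k)) (sym c≡))
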